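{- Let $n\geq 4$ be an integer, $a=f_n^2$, $b=f_{n+1}^2$, $c=f_{n+2}^2$, let $\ell$ be the least non-negative integer with $\ell b\equiv c\pmod a$, $\overline{q}=\left\lfloor \frac{a}{\ell}\right\rfloor$ and $\overline{r}=a-\overline{q}\ell$. Then: if $n\in\{4,6\}$, $b(\ell-\overline{r})<c(\overline{q}+1)$; if $n\geq 8$ is even, $b(\ell-\overline{r})>c(\overline{q}+1)$; if $n\geq 5$ is odd, $b(\ell-\overline{r})>c(\overline{q}+1)$.
   Context: The Fibonacci numbers are defined by $f_0=0$, $f_1=1$, $f_k=f_{k-1}+f_{k-2}$ for $k\geq 2$. -}

module Defs where

open import Data.Nat using (ℕ; zero; suc; _+_; _*_; _≤_; _<_; NonZero)
open import Data.Nat.DivMod using (_/_)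
open import Data.Integer as ℤ using (ℤ; +_)
open import Data.Integer.Divisibility using (_∣_)
open import Data.Product using (_×_)

fib : ℕ → ℕ
fib zero = 0
fib (suc zero) = 1
fib (suc (suc k)) = fib (suc k) + fib k

CongMod : ℕ → ℕ → ℕ → Set
CongMod x y m = (+ m) ∣ ((+ x) ℤ.- (+ y))

A B C : ℕ → ℕ
A n = fib n * fib n
B n = fib (suc n) * fib (suc n)
C n = fib (suc (suc n)) * fib (suc (suc n))

IsLeastℓ : ℕ → ℕ → Set
IsLeastℓ n ℓ = CongMod (ℓ * B n) (C n) (A n)
             × (∀ m → CongMod (m * B n) (C n) (A n) → ℓ ≤ m)

qbar : (n ℓ : ℕ) .{{_ : NonZero ℓ}} → ℕ
qbar n ℓ = A n / ℓ

rbar : (n ℓ : ℕ) .{{_ : NonZero ℓ}} → ℤ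
rbar n ℓ = (+ A n) ℤ.- (+ (qbar n ℓ * ℓ))

lhs : (n ℓ : ℕ) .{{_ : NonZero ℓ}} → ℤ
lhs n ℓ = (+ B n) ℤ.* ((+ ℓ) ℤ.- rbar n ℓ)

rhs : (n ℓ : ℕ) .{{_ : NonZero ℓ}} → ℤ
rhs n ℓ = + (C n * (qbar n ℓ + 1))

{-# OPTIONS --safe #-}
-- Consecutive Fibonacci numbers are coprime, so b = f_{n+1}² is invertible modulo a = f_n² and ℓ is
-- the only solution of ℓ b ≡ c (mod a) below a. Writing F = f_n and N = f_{n+1}, so that c = (N + F)²,
-- the number 1 + F g solves the congruence as soon as g N ≡ 2 (mod F); by Cassini's identity this
-- holds for g = f_{n-3} when n is even and for g = 2 f_{n-2} when n is odd. Then q̄ = 4 (n ≥ 8 even)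
-- or q̄ = 1 (n odd), and ℓ − r̄ = q̄ + 1 + F e with e = 2 f_{n-5}, resp. e = f_{n-2} + f_{n-4}; as
-- c ≤ 4 b, the inequality b (ℓ − r̄) > c (q̄ + 1) follows from 3 (q̄ + 1) < F e. For n = 4, 6 one has
-- ℓ = 4, 17 and both sides are evaluated.
module Submission where

open import Defs
open import Data.Nat
  using (ℕ; zero; suc; _+_; _*_; _∸_; _≤_; _<_; _<?_; NonZero; >-nonZero; >-nonZero⁻¹; z≤n; s≤s; s≤s⁻¹)
open import Data.Nat.Properties
open import Data.Nat.Coprimality using (Coprime; 1-coprimeTo; coprime-+; coprime-divisor)
import Data.Nat.Coprimality as Coprime using (sym)
open import Data.Nat.Divisibility using (_∣_; ∣-refl; ∣-trans; >⇒∤)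
open import Data.Nat.DivMod using (_/_; /-monoˡ-≤; m*n/n≡m; m<n*o⇒m/o<n)
open import Data.Nat.Tactic.RingSolver using (solve; solve-∀)
open import Data.Integer as ℤ using (ℤ; +_)
import Data.Integer.Properties as ℤₚ
import Data.Integer.Coprimality as ℤ using (coprime-divisor)
import Data.Integer.Divisibility as ℤ using (_∣_)
import Data.Integer.Divisibility.Signed as Signed
import Data.Integer.Tactic.RingSolver as ℤ-Solver
open import Data.List using (_∷_; [])
open import Data.Product using (Σ; _,_; _×_; proj₁)
open import Data.Sum using (_⊎_; inj₁; inj₂)
open import Relation.Nullary using (contradiction)
open import Relation.Nullary.Decidable using (from-yes)
open import Relation.Binary.PropositionalEquality

pos-+-* : ∀ x j m → + (x + j * m) ≡ + x ℤ.+ + j ℤ.* + m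
pos-+-* x j m = trans (ℤₚ.pos-+ x (j * m)) (cong (ℤ._+_ (+ x)) (ℤₚ.pos-* j m))

congMod-intro : ∀ {x y m} j k → x + j * m ≡ y + k * m → CongMod x y m
congMod-intro {x} {y} {m} j k eq =
  Signed.∣⇒∣ᵤ (Signed.divides (+ k ℤ.- + j) (difference (+ x) (+ y) (+ j) (+ k) (+ m) eqℤ))
  where
  eqℤ : + x ℤ.+ + j ℤ.* + m ≡ + y ℤ.+ + k ℤ.* + m
  eqℤ = trans (sym (pos-+-* x j m)) (trans (cong +_ eq) (pos-+-* y k m))
  difference : ∀ X Y J K M → X ℤ.+ J ℤ.* M ≡ Y ℤ.+ K ℤ.* M → X ℤ.- Y ≡ (K ℤ.- J) ℤ.* M
  difference X Y J K M e = begin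
    X ℤ.- Y
      ≡⟨ ℤ-Solver.solve (X ∷ Y ∷ J ∷ K ∷ M ∷ []) ⟩
    (X ℤ.+ J ℤ.* M) ℤ.- (Y ℤ.+ K ℤ.* M) ℤ.+ (K ℤ.- J) ℤ.* M
      ≡⟨ cong (λ Z → Z ℤ.- (Y ℤ.+ K ℤ.* M) ℤ.+ (K ℤ.- J) ℤ.* M) e ⟩
    (Y ℤ.+ K ℤ.* M) ℤ.- (Y ℤ.+ K ℤ.* M) ℤ.+ (K ℤ.- J) ℤ.* M
      ≡⟨ ℤ-Solver.solve (Y ∷ J ∷ K ∷ M ∷ []) ⟩
    (K ℤ.- J) ℤ.* M ∎
    where open ≡-Reasoning

congMod-*-cancel : ∀ {m k x y z} → Coprime m k →
  CongMod (x * k) z m → CongMod (y * k) z m → CongMod x y m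
congMod-*-cancel {m} {k} {x} {y} {z} m⊥k xk∼z yk∼z =
  ℤ.coprime-divisor (+ m) (+ k) (+ x ℤ.- + y) m⊥k
    (subst (ℤ._∣_ (+ m)) factor
      (Signed.∣⇒∣ᵤ (Signed.∣m∣n⇒∣m-n (Signed.∣ᵤ⇒∣ {k = + m} {i = + (x * k) ℤ.- + z} xk∼z)
                                     (Signed.∣ᵤ⇒∣ {k = + m} {i = + (y * k) ℤ.- + z} yk∼z))))
  where
  factor : (+ (x * k) ℤ.- + z) ℤ.- (+ (y * k) ℤ.- + z) ≡ + k ℤ.* (+ x ℤ.- + y)
  factor = begin
    (+ (x * k) ℤ.- + z) ℤ.- (+ (y * k) ℤ.- + z)
      ≡⟨ cong₂ (λ X Y → (X ℤ.- + z) ℤ.- (Y ℤ.- + z)) (ℤₚ.pos-* x k) (ℤₚ.pos-* y k) ⟩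
    (+ x ℤ.* + k ℤ.- + z) ℤ.- (+ y ℤ.* + k ℤ.- + z)
      ≡⟨ ring (+ x) (+ y) (+ k) (+ z) ⟩
    + k ℤ.* (+ x ℤ.- + y) ∎
    where
    open ≡-Reasoning
    ring : ∀ X Y K Z → (X ℤ.* K ℤ.- Z) ℤ.- (Y ℤ.* K ℤ.- Z) ≡ K ℤ.* (X ℤ.- Y)
    ring = ℤ-Solver.solve-∀

∣∧<⇒≡0 : ∀ {m n} → m ∣ n → n < m → n ≡ 0
∣∧<⇒≡0 {n = zero}  _   _   = refl
∣∧<⇒≡0 {n = suc _} m∣n n<m = contradiction m∣n (>⇒∤ n<m)

congMod⇒≡ : ∀ {x y m} → CongMod x y m → y ≤ x → x < m → x ≡ y
congMod⇒≡ {x} {y} {m} x∼y y≤x x<m =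
  ≤-antisym (m∸n≡0⇒m≤n (∣∧<⇒≡0 (subst (m ∣_) ∣x-y∣≡x∸y x∼y) (≤-<-trans (m∸n≤m x y) x<m)))
            y≤x
  where
  ∣x-y∣≡x∸y : ℤ.∣ + x ℤ.- + y ∣ ≡ x ∸ y
  ∣x-y∣≡x∸y = cong ℤ.∣_∣ (trans (ℤₚ.m-n≡m⊖n x y) (ℤₚ.⊖-≥ y≤x))

congMod-0ˡ : ∀ {y m} → CongMod 0 y m → m ∣ y
congMod-0ˡ {y} {m} = subst (m ∣_) (trans (ℤₚ.∣i-j∣≡∣j-i∣ (+ 0) (+ y)) (+-identityʳ y))

coprime-*ʳ : ∀ {m n o} → Coprime m n → Coprime m o → Coprime m (n * o)
coprime-*ʳ m⊥n m⊥o (d∣m , d∣no) =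
  m⊥o (d∣m , coprime-divisor (λ (e∣d , e∣n) → m⊥n (∣-trans e∣d d∣m , e∣n)) d∣no)

coprime-square : ∀ {m n} → Coprime m n → Coprime (m * m) (n * n)
coprime-square m⊥n = Coprime.sym (coprime-*ʳ (Coprime.sym m⊥n²) (Coprime.sym m⊥n²))
  where m⊥n² = coprime-*ʳ m⊥n m⊥n

division-bounds : ∀ {a d q ℓ} → a + d ≡ suc q * ℓ → 0 < d → d < ℓ →
  q * ℓ < a × a < suc q * ℓ
division-bounds {a} {d} {q} {ℓ} a+d≡ 0<d d<ℓ = lower , upper
  where
  lower : q * ℓ < a
  lower = +-cancelˡ-< ℓ (q * ℓ) a (begin-strict
    ℓ + q * ℓ ≡⟨ a+d≡ ⟨
    a + d     <⟨ +-monoʳ-< a d<ℓ ⟩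
    a + ℓ     ≡⟨ +-comm a ℓ ⟩
    ℓ + a     ∎)
    where open ≤-Reasoning
  upper : a < suc q * ℓ
  upper = <-≤-trans (m<m+n a 0<d) (≤-reflexive a+d≡)

a/ℓ≡q : ∀ {a d q ℓ} .{{_ : NonZero ℓ}} → a + d ≡ suc q * ℓ → 0 < d → d < ℓ → a / ℓ ≡ q
a/ℓ≡q {a} {d} {q} {ℓ} a+d≡ 0<d d<ℓ with division-bounds {q = q} a+d≡ 0<d d<ℓ
... | lower , upper =
  ≤-antisym (s≤s⁻¹ (m<n*o⇒m/o<n upper))
            (subst (_≤ a / ℓ) (m*n/n≡m q ℓ) (/-monoˡ-≤ ℓ (<⇒≤ lower)))

-- d = ℓ − r̄ in the notation of the paper.
lhs>rhs-criterion : ∀ {a b c ℓ q d} .{{_ : NonZero ℓ}} → a + d ≡ suc q * ℓ → 0 < d → d < ℓ →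
  c * (q + 1) < b * d →
  + b ℤ.* (+ ℓ ℤ.- (+ a ℤ.- + (a / ℓ * ℓ))) ℤ.> + (c * (a / ℓ + 1))
lhs>rhs-criterion {a} {b} {c} {ℓ} {q} {d} a+d≡ 0<d d<ℓ c[q+1]<bd
  = subst (λ x → + b ℤ.* (+ ℓ ℤ.- (+ a ℤ.- + (x * ℓ))) ℤ.> + (c * (x + 1)))
          (sym (a/ℓ≡q {q = q} a+d≡ 0<d d<ℓ))
          (subst (+ (c * (q + 1)) ℤ.<_) (sym lhs≡bd) (ℤ.+<+ c[q+1]<bd))
  where
  lhs≡bd : + b ℤ.* (+ ℓ ℤ.- (+ a ℤ.- + (q * ℓ))) ≡ + (b * d)
  lhs≡bd = begin
    + b ℤ.* (+ ℓ ℤ.- (+ a ℤ.- + (q * ℓ)))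
      ≡⟨ cong (λ X → + b ℤ.* (+ ℓ ℤ.- (+ a ℤ.- X))) (ℤₚ.pos-* q ℓ) ⟩
    + b ℤ.* (+ ℓ ℤ.- (+ a ℤ.- + q ℤ.* + ℓ))
      ≡⟨ cancel (+ a) (+ b) (+ d) (+ ℓ) (+ q) a+d≡ℓ+qℓ ⟩
    + b ℤ.* + d
      ≡⟨ ℤₚ.pos-* b d ⟨
    + (b * d) ∎
    where
    open ≡-Reasoning
    a+d≡ℓ+qℓ : + a ℤ.+ + d ≡ + ℓ ℤ.+ + q ℤ.* + ℓ
    a+d≡ℓ+qℓ = trans (sym (ℤₚ.pos-+ a d)) (trans (cong +_ a+d≡) (pos-+-* ℓ q ℓ))
    cancel : ∀ A B D L Q → A ℤ.+ D ≡ L ℤ.+ Q ℤ.* L →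
             B ℤ.* (L ℤ.- (A ℤ.- Q ℤ.* L)) ≡ B ℤ.* D
    cancel A B D L Q e = begin
      B ℤ.* (L ℤ.- (A ℤ.- Q ℤ.* L)) ≡⟨ ℤ-Solver.solve (A ∷ B ∷ L ∷ Q ∷ []) ⟩
      B ℤ.* ((L ℤ.+ Q ℤ.* L) ℤ.- A)  ≡⟨ cong (λ Z → B ℤ.* (Z ℤ.- A)) e ⟨
      B ℤ.* ((A ℤ.+ D) ℤ.- A)        ≡⟨ ℤ-Solver.solve (A ∷ B ∷ D ∷ []) ⟩
      B ℤ.* D                        ∎
      where open ≡-Reasoning

fib-+ : ∀ k m → fib (suc k + m) ≡ fib (suc k) * fib (suc m) + fib k * fib m
fib-+ zero          m = sym (trans (+-identityʳ _) (*-identityˡ _))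
fib-+ (suc zero)    m = sym (cong₂ _+_ (*-identityˡ (fib (suc m))) (*-identityˡ (fib m)))
fib-+ (suc (suc k)) m = trans (cong₂ _+_ (fib-+ (suc k) m) (fib-+ k m))
  (regroup (fib (2 + k)) (fib (1 + k)) (fib k) (fib (1 + m)) (fib m))
  where
  regroup : ∀ a b c x y → (a * x + b * y) + (b * x + c * y) ≡ (a + b) * x + (b + c) * y
  regroup = solve-∀

cassini-even : ∀ i → fib (3 + 2 * i) * fib (1 + 2 * i) ≡ fib (2 + 2 * i) * fib (2 + 2 * i) + 1
cassini-even zero    = refl
cassini-even (suc i) =
  subst (λ x → fib (3 + x) * fib (1 + x) ≡ fib (2 + x) * fib (2 + x) + 1) (sym (*-suc 2 i))
        (two-steps (fib (2 + 2 * i)) (fib (1 + 2 * i)) (cassini-even i))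
  where
  two-steps : ∀ p s → (p + s) * s ≡ p * p + 1 →
              ((p + s) + p + (p + s)) * (p + s) ≡ ((p + s) + p) * ((p + s) + p) + 1
  two-steps p s eq = begin
    ((p + s) + p + (p + s)) * (p + s)            ≡⟨ solve (p ∷ s ∷ []) ⟩
    (p + s) * s + (3 * p * p + 4 * p * s + s * s) ≡⟨ cong (_+ (3 * p * p + 4 * p * s + s * s)) eq ⟩
    p * p + 1 + (3 * p * p + 4 * p * s + s * s)   ≡⟨ solve (p ∷ s ∷ []) ⟩
    ((p + s) + p) * ((p + s) + p) + 1            ∎
    where open ≡-Reasoning

fib-pos : ∀ m → 0 < fib (suc m)
fib-pos zero    = s≤s z≤n
fib-pos (suc m) = <-≤-trans (fib-pos m) (m≤m+n _ _)

fib-nonZero : ∀ m → NonZero (fib (suc m))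
fib-nonZero m = >-nonZero (fib-pos m)

fib≤fib-suc : ∀ n → fib n ≤ fib (suc n)
fib≤fib-suc zero    = z≤n
fib≤fib-suc (suc n) = m≤m+n _ _

fib-coprime : ∀ n → Coprime (fib n) (fib (suc n))
fib-coprime zero    = Coprime.sym (1-coprimeTo 0)
fib-coprime (suc n) = Coprime.sym (coprime-+ (fib-coprime n))

fib-coprime-2+ : ∀ n → Coprime (fib n) (fib (2 + n))
fib-coprime-2+ n = subst (Coprime (fib n)) (+-comm (fib n) (fib (1 + n)))
  (Coprime.sym (coprime-+ (Coprime.sym (fib-coprime n))))

A⊥B : ∀ n → Coprime (A n) (B n)
A⊥B n = coprime-square (fib-coprime n)

leastℓ-unique : ∀ {n ℓ ℓ₀} → CongMod (ℓ₀ * B n) (C n) (A n) → ℓ₀ < A n →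
  IsLeastℓ n ℓ → ℓ ≡ ℓ₀
leastℓ-unique {n} {ℓ} {ℓ₀} ℓ₀-sol ℓ₀<a (ℓ-sol , ℓ-least) = sym (congMod⇒≡ {ℓ₀} {ℓ}
  (congMod-*-cancel {x = ℓ₀} {ℓ} {C n} (A⊥B n) ℓ₀-sol ℓ-sol) (ℓ-least ℓ₀ ℓ₀-sol) ℓ₀<a)

leastℓ-nonZero : ∀ {n ℓ} → 3 ≤ n → IsLeastℓ n ℓ → NonZero ℓ
leastℓ-nonZero {ℓ = suc _} _ _ = _
leastℓ-nonZero {n} {zero} (s≤s (s≤s (s≤s (z≤n {j})))) (0∼c , _) =
  contradiction (m*n≡1⇒m≡1 (fib n) (fib n) A≡1) (>⇒≢ 2≤fib)
  where
  A≡1 : A n ≡ 1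
  A≡1 = coprime-square (fib-coprime-2+ n) (∣-refl , congMod-0ˡ 0∼c)
  2≤fib : 2 ≤ fib n
  2≤fib = +-mono-≤ (fib-pos (suc j)) (fib-pos j)

cong-lhs-rhs : ∀ {n ℓ ℓ₀} (R : ℤ → ℤ → Set) .{{_ : NonZero ℓ}} .{{_ : NonZero ℓ₀}} →
  ℓ ≡ ℓ₀ → R (lhs n ℓ₀) (rhs n ℓ₀) → R (lhs n ℓ) (rhs n ℓ)
cong-lhs-rhs R refl r = r

solution-identity : ∀ F N g t → g * N ≡ 2 + F * t →
  (1 + F * g) * (N * N) + 1 * (F * F) ≡ (N + F) * (N + F) + (N * t) * (F * F)
solution-identity F N g t gN≡2+Ft = begin
  (1 + F * g) * (N * N) + 1 * (F * F)   ≡⟨ solve (F ∷ N ∷ g ∷ []) ⟩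
  N * N + F * F + F * N * (g * N)       ≡⟨ cong (λ x → N * N + F * F + F * N * x) gN≡2+Ft ⟩
  N * N + F * F + F * N * (2 + F * t)   ≡⟨ solve (F ∷ N ∷ t ∷ []) ⟩
  (N + F) * (N + F) + (N * t) * (F * F) ∎
  where open ≡-Reasoning

division-identity : ∀ F q h e → F ≡ q * (h + e) + h →
  F * F + ((q + 1) + F * e) ≡ suc q * (1 + F * (h + e))
division-identity F q h e F≡ = begin
  F * F + ((q + 1) + F * e)             ≡⟨ solve (F ∷ q ∷ e ∷ []) ⟩
  (q + 1) + F * (F + e)                 ≡⟨ cong (λ x → (q + 1) + F * (x + e)) F≡ ⟩
  (q + 1) + F * (q * (h + e) + h + e)   ≡⟨ solve (F ∷ q ∷ h ∷ e ∷ []) ⟩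
  (1 + q) * (1 + F * (h + e))           ∎
  where open ≡-Reasoning

square-comparison : ∀ {F N q x} .{{_ : NonZero N}} → F ≤ N → 3 * (q + 1) < x →
  (N + F) * (N + F) * (q + 1) < N * N * ((q + 1) + x)
square-comparison {F} {N} {q} {x} F≤N 3[q+1]<x = begin-strict
  (N + F) * (N + F) * (q + 1) ≤⟨ *-monoˡ-≤ (q + 1) (*-mono-≤ N+F≤N+N N+F≤N+N) ⟩
  (N + N) * (N + N) * (q + 1) ≡⟨ solve (N ∷ q ∷ []) ⟩
  N * N * (4 * (q + 1))       <⟨ *-monoʳ-< (N * N) {{m*n≢0 N N}} (+-monoʳ-< (q + 1) 3[q+1]<x) ⟩
  N * N * ((q + 1) + x)       ∎
  where
  open ≤-Reasoning
  N+F≤N+N = +-monoʳ-≤ N F≤N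

-- With F = f_n and N = f_{n+1}: ℓ₀ is the least ℓ, q̄ = q and ℓ₀ − r̄ = d.
record Certificate (F N : ℕ) : Set where
  field
    q h e t       : ℕ
    1≤q           : 1 ≤ q
    F≡q[h+e]+h    : F ≡ q * (h + e) + h
    q<F*h         : q < F * h
    3[q+1]<F*e    : 3 * (q + 1) < F * e
    [h+e]*N≡2+F*t : (h + e) * N ≡ 2 + F * t

  ℓ₀ : ℕ
  ℓ₀ = 1 + F * (h + e)

  d : ℕ
  d = (q + 1) + F * e

  division : F * F + d ≡ suc q * ℓ₀
  division = division-identity F q h e F≡q[h+e]+h

  0<d : 0 < d
  0<d = <-≤-trans 1≤q (≤-trans (m≤m+n q 1) (m≤m+n (q + 1) (F * e)))

  d<ℓ₀ : d < ℓ₀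
  d<ℓ₀ = begin-strict
    (q + 1) + F * e     ≡⟨ cong (_+ F * e) (+-comm q 1) ⟩
    suc (q + F * e)     <⟨ s≤s (+-monoˡ-< (F * e) q<F*h) ⟩
    suc (F * h + F * e) ≡⟨ cong suc (*-distribˡ-+ F h e) ⟨
    ℓ₀                  ∎
    where open ≤-Reasoning

  ℓ₀<F*F : ℓ₀ < F * F
  ℓ₀<F*F = ≤-<-trans (m≤n*m ℓ₀ q {{>-nonZero 1≤q}})
                     (proj₁ (division-bounds {q = q} division 0<d d<ℓ₀))

certificate⇒leastℓ : ∀ {n ℓ} (cert : Certificate (fib n) (fib (suc n))) → IsLeastℓ n ℓ →
  ℓ ≡ Certificate.ℓ₀ cert
certificate⇒leastℓ {n} cert = leastℓ-unique {n} ℓ₀-solution ℓ₀<F*F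
  where
  open Certificate cert
  ℓ₀-solution : CongMod (ℓ₀ * B n) (C n) (A n)
  ℓ₀-solution = congMod-intro 1 (fib (suc n) * t)
    (solution-identity (fib n) (fib (suc n)) (h + e) t [h+e]*N≡2+F*t)

lhs>rhs-at-ℓ₀ : ∀ {n} (cert : Certificate (fib n) (fib (suc n))) →
  lhs n (Certificate.ℓ₀ cert) ℤ.> rhs n (Certificate.ℓ₀ cert)
lhs>rhs-at-ℓ₀ {n} cert = lhs>rhs-criterion {A n} {B n} {C n} {q = q} division 0<d d<ℓ₀
  (square-comparison {{fib-nonZero n}} (fib≤fib-suc n) 3[q+1]<F*e)
  where open Certificate cert

certificate⇒lhs>rhs : ∀ {n ℓ} .{{_ : NonZero ℓ}} → Certificate (fib n) (fib (suc n)) →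
  IsLeastℓ n ℓ → lhs n ℓ ℤ.> rhs n ℓ
certificate⇒lhs>rhs {n} cert least =
  cong-lhs-rhs {n} ℤ._>_ (certificate⇒leastℓ {n} cert least) (lhs>rhs-at-ℓ₀ {n} cert)

-- For n = 8 + 2i and (s, p) = (f_{n-7}, f_{n-6}): h + e = f_{n-3} and t = f_{n-2}.
cassini⇒certificate-even : ∀ {p s} .{{_ : NonZero p}} → (p + s) * s ≡ p * p + 1 →
  Certificate (13 * p + 8 * s) (21 * p + 13 * s)
cassini⇒certificate-even {p} {s} cassini-ps = record
  { q = 4 ; h = p ; e = 2 * (p + s) ; t = 5 * p + 3 * s
  ; 1≤q           = s≤s z≤n
  ; F≡q[h+e]+h    = solve (p ∷ s ∷ [])
  ; q<F*h         = <-≤-trans (from-yes (4 <? 13)) (≤-trans 13≤F (m≤m*n F p))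
  ; 3[q+1]<F*e    = <-≤-trans (from-yes (15 <? 26)) (*-mono-≤ 13≤F 2≤e)
  ; [h+e]*N≡2+F*t = begin
      (p + 2 * (p + s)) * (21 * p + 13 * s)
        ≡⟨ solve (p ∷ s ∷ []) ⟩
      2 * ((p + s) * s) + (63 * p * p + 79 * p * s + 24 * s * s)
        ≡⟨ cong (λ x → 2 * x + (63 * p * p + 79 * p * s + 24 * s * s)) cassini-ps ⟩
      2 * (p * p + 1) + (63 * p * p + 79 * p * s + 24 * s * s)
        ≡⟨ solve (p ∷ s ∷ []) ⟩
      2 + (13 * p + 8 * s) * (5 * p + 3 * s) ∎
  }
  where
  open ≡-Reasoning
  F = 13 * p + 8 * s
  13≤F : 13 ≤ F
  13≤F = ≤-trans (m≤m*n 13 p) (m≤m+n (13 * p) (8 * s))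
  2≤e : 2 ≤ 2 * (p + s)
  2≤e = ≤-trans (m≤m*n 2 p) (*-monoʳ-≤ 2 (m≤m+n p s))

-- For n = 5 + 2i and (s, p) = (f_{n-4}, f_{n-3}): h + e = 2 f_{n-2} and t = 2 f_{n-1}.
cassini⇒certificate-odd : ∀ {p s} .{{_ : NonZero p}} .{{_ : NonZero s}} → (p + s) * s ≡ p * p + 1 →
  Certificate (3 * p + 2 * s) (5 * p + 3 * s)
cassini⇒certificate-odd {p} {s} cassini-ps = record
  { q = 1 ; h = p ; e = p + 2 * s ; t = 2 * (2 * p + s)
  ; 1≤q           = s≤s z≤n
  ; F≡q[h+e]+h    = solve (p ∷ s ∷ [])
  ; q<F*h         = <-≤-trans (from-yes (1 <? 5)) (≤-trans 5≤F (m≤m*n F p))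
  ; 3[q+1]<F*e    = <-≤-trans (from-yes (6 <? 15)) (*-mono-≤ 5≤F 3≤e)
  ; [h+e]*N≡2+F*t = begin
      (p + (p + 2 * s)) * (5 * p + 3 * s)
        ≡⟨ solve (p ∷ s ∷ []) ⟩
      2 * ((p + s) * s) + (10 * p * p + 14 * p * s + 4 * s * s)
        ≡⟨ cong (λ x → 2 * x + (10 * p * p + 14 * p * s + 4 * s * s)) cassini-ps ⟩
      2 * (p * p + 1) + (10 * p * p + 14 * p * s + 4 * s * s)
        ≡⟨ solve (p ∷ s ∷ []) ⟩
      2 + (3 * p + 2 * s) * (2 * (2 * p + s)) ∎
  }
  where
  open ≡-Reasoning
  F = 3 * p + 2 * s
  5≤F : 5 ≤ F
  5≤F = +-mono-≤ (m≤m*n 3 p) (m≤m*n 2 s)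
  3≤e : 3 ≤ p + 2 * s
  3≤e = +-mono-≤ (>-nonZero⁻¹ p) (m≤m*n 2 s)

fib-certificate-even : ∀ i → Certificate (fib (8 + 2 * i)) (fib (9 + 2 * i))
fib-certificate-even i = subst₂ Certificate (sym (fib-+ 6 (1 + 2 * i))) (sym (fib-+ 7 (1 + 2 * i)))
  (cassini⇒certificate-even {{fib-nonZero (1 + 2 * i)}} (cassini-even i))

fib-certificate-odd : ∀ i → Certificate (fib (5 + 2 * i)) (fib (6 + 2 * i))
fib-certificate-odd i = subst₂ Certificate (sym (fib-+ 3 (1 + 2 * i))) (sym (fib-+ 4 (1 + 2 * i)))
  (cassini⇒certificate-odd {{fib-nonZero (1 + 2 * i)}} {{fib-nonZero (2 * i)}} (cassini-even i))

leastℓ-4 : ∀ {ℓ} → IsLeastℓ 4 ℓ → ℓ ≡ 4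
leastℓ-4 = leastℓ-unique {4} (congMod-intro {4 * B 4} {C 4} 0 4 refl) (from-yes (4 <? 9))

leastℓ-6 : ∀ {ℓ} → IsLeastℓ 6 ℓ → ℓ ≡ 17
leastℓ-6 = leastℓ-unique {6} (congMod-intro {17 * B 6} {C 6} 0 38 refl) (from-yes (17 <? 64))

lhs<rhs-small : ∀ {n ℓ} .{{_ : NonZero ℓ}} → IsLeastℓ n ℓ → n ≡ 4 ⊎ n ≡ 6 →
  lhs n ℓ ℤ.< rhs n ℓ
lhs<rhs-small least (inj₁ refl) =
  cong-lhs-rhs {4} ℤ._<_ (leastℓ-4 least) (from-yes (lhs 4 4 ℤₚ.<? rhs 4 4))
lhs<rhs-small least (inj₂ refl) =
  cong-lhs-rhs {6} ℤ._<_ (leastℓ-6 least) (from-yes (lhs 6 17 ℤₚ.<? rhs 6 17))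

lhs>rhs-even : ∀ {n ℓ} .{{_ : NonZero ℓ}} → IsLeastℓ n ℓ → (k : ℕ) → 4 ≤ k → n ≡ 2 * k →
  lhs n ℓ ℤ.> rhs n ℓ
lhs>rhs-even {n} least _ (s≤s (s≤s (s≤s (s≤s (z≤n {i}))))) n≡2k = certificate⇒lhs>rhs {n}
  (subst (λ m → Certificate (fib m) (fib (suc m))) (sym (trans n≡2k (*-distribˡ-+ 2 4 i)))
         (fib-certificate-even i))
  least

lhs>rhs-odd : ∀ {n ℓ} .{{_ : NonZero ℓ}} → IsLeastℓ n ℓ → (k : ℕ) → 2 ≤ k → n ≡ suc (2 * k) →
  lhs n ℓ ℤ.> rhs n ℓ
lhs>rhs-odd {n} least _ (s≤s (s≤s (z≤n {i}))) n≡1+2k = certificate⇒lhs>rhs {n}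
  (subst (λ m → Certificate (fib m) (fib (suc m))) (sym (trans n≡1+2k (cong suc (*-distribˡ-+ 2 2 i))))
         (fib-certificate-odd i))
  least

corollary4p21 : (n : ℕ) → 4 ≤ n → (ℓ : ℕ) → IsLeastℓ n ℓ →
    Σ (NonZero ℓ) λ nz →
      ((n ≡ 4 ⊎ n ≡ 6) → ℤ._<_ (lhs n ℓ {{nz}}) (rhs n ℓ {{nz}}))
      × ((k : ℕ) → 4 ≤ k → n ≡ 2 * k → ℤ._>_ (lhs n ℓ {{nz}}) (rhs n ℓ {{nz}}))
      × ((k : ℕ) → 2 ≤ k → n ≡ suc (2 * k) → ℤ._>_ (lhs n ℓ {{nz}}) (rhs n ℓ {{nz}}))
corollary4p21 n 4≤n ℓ least =
  nz , lhs<rhs-small {{nz}} least , lhs>rhs-even {{nz}} least , lhs>rhs-odd {{nz}} least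
  where nz = leastℓ-nonZero (≤-trans (n≤1+n 3) 4≤n) least
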